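{- Let $G$ be a connected graph that has a matching bond with $m$ edges. Consider the generalized Broadcast problem on $G$ in which initially $k_1\ge 1$ ignorant agents and $k_2\ge 1$ source agents are placed at distinct nodes. If $k_1+k_2\le m-1$, then the adversary has a winning strategy, i.e. it can prevent forever that all agents become source agents.
   Context: A bond of a graph is a minimal cut set of edges: a set of edges whose removal disconnects the graph, but such that removing all but any one of its edges leaves the graph connected. A matching bond is a bond whose edges are pairwise vertex-disjoint. Dynamic-graph Broadcast model: a connected base graph $G=(V,E)$ is given and time proceeds in synchronous rounds. In each round the adversary first removes a (possibly empty) set $E'\subseteq E$ such that $(V,E\setminus E')$ is connected; then each agent, after local computation and communication with agents at the same node, either stays or moves along one edge of $E\setminus E'$ incident to its node; all agents move simultaneously. Agents have unique IDs, local memory, and full knowledge at every round of $G$, the current edge set, and the positions and knowledge status of all agents. Source agents hold a message $\mathcal M$; an ignorant agent becomes a source agent when at the same node as a source agent. The initial placement of the agents (at distinct nodes) is chosen by the adversary. The agents win if, for every adversary behavior, all agents become source agents within finitely many rounds; otherwise the adversary has a winning strategy. -}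

module Defs where

open import Data.Nat using (ℕ; zero; suc; _≤ᵇ_)
open import Data.Bool using (Bool; true; false; _∧_; _∨_; not)
open import Data.Fin using (Fin; toℕ; _≟_)
open import Data.List using (List; allFin)
open import Data.Bool.ListAction using (any)
open import Data.Product using (Σ; _×_; _,_; proj₁; proj₂)
open import Data.Sum using (_⊎_)
open import Relation.Binary.PropositionalEquality using (_≡_; _≢_)
open import Relation.Nullary using (¬_)
open import Relation.Nullary.Decidable using (⌊_⌋)
open import Function.Definitions using (Injective)

EdgeRel : ℕ → Set
EdgeRel n = Fin n → Fin n → Bool

record Graph (n : ℕ) : Set where
  field
    E      : EdgeRel n
    sym    : ∀ u v → E u v ≡ E v u
    irrefl : ∀ u → E u u ≡ false
open Graph public

data Path {n : ℕ} (E : EdgeRel n) : Fin n → Fin n → Set where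
  here : ∀ {u} → Path E u u
  step : ∀ {u w v} → E u w ≡ true → Path E w v → Path E u v

ConnectedRel : ∀ {n} → EdgeRel n → Set
ConnectedRel {n} E = ∀ (u v : Fin n) → Path E u v

Connected : ∀ {n} → Graph n → Set
Connected G = ConnectedRel (E G)

_minus_ : ∀ {n} → EdgeRel n → EdgeRel n → EdgeRel n
(E minus R) u v = E u v ∧ not (R u v)

-- Bonds given by an indexed family of m edges b : Fin m → Fin n × Fin n.

isEdge : ∀ {n} → Fin n × Fin n → Fin n → Fin n → Bool
isEdge (x , y) u v = (⌊ x ≟ u ⌋ ∧ ⌊ y ≟ v ⌋) ∨ (⌊ x ≟ v ⌋ ∧ ⌊ y ≟ u ⌋)

edgesOf : ∀ {n m} → (Fin m → Fin n × Fin n) → (Fin m → Bool) → EdgeRel n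
edgesOf {n} {m} b S u v = any (λ j → S j ∧ isEdge (b j) u v) (allFin m)

allBut : ∀ {m} → Fin m → Fin m → Bool
allBut i j = not ⌊ j ≟ i ⌋

everything : ∀ {m} → Fin m → Bool
everything _ = true

IsBond : ∀ {n m} → Graph n → (Fin m → Fin n × Fin n) → Set
IsBond G b =
  (∀ i → E G (proj₁ (b i)) (proj₂ (b i)) ≡ true)
  × ¬ ConnectedRel (E G minus edgesOf b everything)
  × (∀ i → ConnectedRel (E G minus edgesOf b (allBut i)))

IsMatching : ∀ {n m} → (Fin m → Fin n × Fin n) → Set
IsMatching b = ∀ i j → i ≢ j →
  (proj₁ (b i) ≢ proj₁ (b j)) × (proj₁ (b i) ≢ proj₂ (b j)) ×
  (proj₂ (b i) ≢ proj₁ (b j)) × (proj₂ (b i) ≢ proj₂ (b j))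

HasMatchingBond : ∀ {n} → Graph n → ℕ → Set
HasMatchingBond {n} G m =
  Σ (Fin m → Fin n × Fin n) λ b → IsBond G b × IsMatching b

module Game {n : ℕ} (G : Graph n) (k : ℕ) where

  record Removal : Set where
    field
      R     : EdgeRel n
      R⊆E   : ∀ u v → R u v ≡ true → E G u v ≡ true
      Rsym  : ∀ u v → R u v ≡ R v u
      conn  : ConnectedRel (E G minus R)
  open Removal public

  -- positions of all agents and their knowledge status (true = source)
  record State : Set where
    constructor ⟨_,_⟩
    field
      pos : Fin k → Fin n
      inf : Fin k → Bool
  open State public

  data History : Set where
    start : State → History
    _▷_   : History → Removal × State → History

  current : History → State
  current (start s)       = s
  current (h ▷ (_ , s))   = s

  Moves : State → Removal → Set
  Moves s r = (i : Fin k) →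
    Σ (Fin n) λ v → (v ≡ pos s i) ⊎ ((E G minus R r) (pos s i) v ≡ true)

  AdvStrategy : Set
  AdvStrategy = History → Removal

  -- agents (full knowledge, so jointly): choose moves from the full
  -- history and the current edge set
  AgentStrategy : Set
  AgentStrategy = (h : History) → (r : Removal) → Moves (current h) r

  update : State → (Fin k → Fin n) → State
  update s p = ⟨ p , (λ i → inf s i ∨ any (λ j → inf s j ∧ ⌊ p j ≟ p i ⌋) (allFin k)) ⟩

  play : State → AdvStrategy → AgentStrategy → ℕ → History
  play s₀ A P zero    = start s₀
  play s₀ A P (suc t) =
    let h = play s₀ A P t
        r = A h
        mv = P h r
    in h ▷ (r , update (current h) (λ i → proj₁ (mv i)))

  AllSources : State → Set
  AllSources s = ∀ i → inf s i ≡ true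

-- Initial configuration with k₁ ignorant and k₂ source agents:
-- agents 0..k₁-1 are ignorant, agents k₁..k₁+k₂-1 are sources
-- (agent IDs are arbitrary labels, so this is no loss of generality).
initial : ∀ {n} (G : Graph n) (k₁ k₂ : ℕ) →
          (Fin (k₁ Data.Nat.+ k₂) → Fin n) → Game.State G (k₁ Data.Nat.+ k₂)
initial G k₁ k₂ p = Game.⟨_,_⟩ p (λ i → k₁ ≤ᵇ toℕ i)

AdversaryWins : ∀ {n} → Graph n → ℕ → ℕ → Set
AdversaryWins {n} G k₁ k₂ =
  Σ (Fin (k₁ Data.Nat.+ k₂) → Fin n) λ p →
    Injective _≡_ _≡_ p ×
    Σ (Game.AdvStrategy G (k₁ Data.Nat.+ k₂)) λ A →
      (P : Game.AgentStrategy G (k₁ Data.Nat.+ k₂)) → (t : ℕ) →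
        ¬ Game.AllSources G (k₁ Data.Nat.+ k₂)
            (Game.current G (k₁ Data.Nat.+ k₂)
              (Game.play G (k₁ Data.Nat.+ k₂) (initial G k₁ k₂ p) A P t))

{-# OPTIONS --safe #-}
module Submission where

-- Deleting all edges of the bond b disconnects G, so the vertices reachable from some vertex
-- in what remains form one side of a partition that no remaining edge crosses; every bond
-- edge does cross it, since re-adding that edge alone reconnects G. The adversary puts each
-- ignorant agent on the inner and each source on the outer endpoint of its own bond edge.
-- With fewer agents than bond edges, in every round some bond edge has no agent at either
-- endpoint, and the adversary deletes all the other bond edges: then no agent can change
-- side, so no source ever meets an ignorant agent.

open import Defs
open import Data.Nat using (ℕ; _+_; _∸_; _≤_; _<_; zero; suc; z≤n; s≤s; _≤ᵇ_)
import Data.Nat.Properties as ℕ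
open import Data.Bool using (Bool; true; false; _∧_; not; T)
open import Data.Bool.Properties using (T-≡; T-not-≡; T-∧; T-∨; ∧-conicalˡ; ∧-conicalʳ; ∨-comm; ¬-not)
  renaming (_≟_ to _≟ᵇ_)
open import Data.Fin using (Fin; toℕ; _≟_; inject≤) renaming (zero to fzero)
import Data.Fin.Properties as Fin
open import Data.Fin.Subset using (Subset; _∈_; _∉_; _⊆_; ⁅_⁆; _∪_; ∣_∣)
open import Data.Fin.Subset.Properties
  using (_∈?_; ∈⊤; x∈⁅x⁆; x∈⁅y⁆⇒x≡y; p⊆p∪q; x∈p∪q⁺; x∈p∪q⁻; ∣p∣≤n; ∣p∣≡n⇒p≡⊤; p⊂q⇒∣p∣<∣q∣)
open import Data.List using (allFin)
open import Data.List.Properties using (map-cong)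
open import Data.Bool.ListAction using (or)
open import Data.List.Membership.Propositional.Properties using (∈-allFin)
open import Data.List.Relation.Unary.Any as Any using (satisfied)
open import Data.List.Relation.Unary.Any.Properties using (any⁺; any⁻)
open import Data.Product using (Σ-syntax; ∃; ∃₂; _×_; _,_; proj₁; proj₂)
import Data.Sum as Sum
open import Data.Sum using (_⊎_; inj₁; inj₂)
open import Data.Empty using (⊥; ⊥-elim)
open import Function using (_∘_; id)
open import Function.Bundles using (module Equivalence)
open import Function.Definitions using (Injective)
open import Relation.Binary.PropositionalEquality
  using (_≡_; _≢_; refl; cong; cong₂; subst; trans; module ≡-Reasoning) renaming (sym to ≡-sym)
open import Relation.Nullary using (¬_; Dec; yes; no; does; ¬?; contradiction)
open import Relation.Nullary.Decidable using (⌊_⌋; toWitness; dec-true; dec-false; isYes≗does; decidable-stable; _×-dec_; _⊎-dec_)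

open Equivalence using (to; from)

minus⁻ : ∀ {n} (F R : EdgeRel n) {u v} → (F minus R) u v ≡ true → F u v ≡ true × R u v ≡ false
minus⁻ F R {u} {v} e =
  ∧-conicalˡ (F u v) _ e , T-not-≡ .to (T-≡ .from (∧-conicalʳ (F u v) _ e))

minus⁺ : ∀ {n} (F R : EdgeRel n) {u v} → F u v ≡ true → R u v ≡ false → (F minus R) u v ≡ true
minus⁺ _ _ f r = cong₂ (λ x y → x ∧ not y) f r

Endpoint : ∀ {n} → Fin n × Fin n → Fin n → Set
Endpoint (x , y) w = w ≡ x ⊎ w ≡ y

isEdge⁻ : ∀ {n} (e : Fin n × Fin n) {u v} → isEdge e u v ≡ true → e ≡ (u , v) ⊎ e ≡ (v , u)
isEdge⁻ (x , y) {u} {v} e = Sum.map (pair (x ≟ u) (y ≟ v)) (pair (x ≟ v) (y ≟ u)) (T-∨ .to (T-≡ .from e))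
  where
  pair : ∀ {a b c d : Fin _} (p : Dec (a ≡ c)) (q : Dec (b ≡ d)) → T (⌊ p ⌋ ∧ ⌊ q ⌋) → (a , b) ≡ (c , d)
  pair p q t = cong₂ _,_ (toWitness {a? = p} (proj₁ (T-∧ .to t))) (toWitness {a? = q} (proj₂ (T-∧ .to t)))

isEdge⇒endpoints : ∀ {n} (e : Fin n × Fin n) {u v} → isEdge e u v ≡ true → Endpoint e u × Endpoint e v
isEdge⇒endpoints e uv with isEdge⁻ e uv
... | inj₁ refl = inj₁ refl , inj₂ refl
... | inj₂ refl = inj₂ refl , inj₁ refl

isEdge-sym : ∀ {n} (e : Fin n × Fin n) u v → isEdge e u v ≡ isEdge e v u
isEdge-sym (x , y) u v = ∨-comm (⌊ x ≟ u ⌋ ∧ ⌊ y ≟ v ⌋) _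

allBut-≢ : ∀ {m} {i j : Fin m} → j ≢ i → allBut i j ≡ true
allBut-≢ {i = i} {j} j≢i = cong not (trans (isYes≗does (j ≟ i)) (dec-false (j ≟ i) j≢i))

module _ {n m : ℕ} (b : Fin m → Fin n × Fin n) where

  edgesOf⁻ : ∀ {S u v} → edgesOf b S u v ≡ true → ∃ λ j → S j ≡ true × isEdge (b j) u v ≡ true
  edgesOf⁻ e with satisfied (any⁻ _ (allFin m) (T-≡ .from e))
  ... | j , t = j , T-≡ .to (proj₁ (T-∧ .to t)) , T-≡ .to (proj₂ (T-∧ .to t))

  edgesOf⁺ : ∀ {S u v} j → S j ≡ true → isEdge (b j) u v ≡ true → edgesOf b S u v ≡ true
  edgesOf⁺ j s e = T-≡ .to (any⁺ _ (Any.map (λ { refl → T-∧ .from (T-≡ .from s , T-≡ .from e) }) (∈-allFin j)))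

  edgesOf-sym : ∀ S u v → edgesOf b S u v ≡ edgesOf b S v u
  edgesOf-sym S u v = cong or (map-cong (λ j → cong (S j ∧_) (isEdge-sym (b j) u v)) (allFin m))

record Separation {n : ℕ} (F : EdgeRel n) : Set where
  field
    side       : Fin n → Bool
    side-resp  : ∀ {w z} → F w z ≡ true → side w ≡ side z
    inner      : Fin n
    outer      : Fin n
    inner-side : side inner ≡ true
    outer-side : side outer ≡ false

module _ {n : ℕ} (F : EdgeRel n) where

  path-snoc : ∀ {u w z} → Path F u w → F w z ≡ true → Path F u z
  path-snoc here        e = step e here
  path-snoc (step e′ p) e = step e′ (path-snoc p e)

  path-crosses : (side : Fin n → Bool) → ∀ {a c} → Path F a c → side a ≡ true → side c ≡ false →
                 ∃₂ λ w z → side w ≡ true × side z ≡ false × F w z ≡ true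
  path-crosses side here                 a-in c-out = contradiction (trans (≡-sym a-in) c-out) λ ()
  path-crosses side {a} (step {w = w} e p) a-in c-out with side w in w-side
  ... | true  = path-crosses side p w-side c-out
  ... | false = a , w , a-in , w-side , e

  Closed : Subset n → Set
  Closed S = ∀ {w z} → w ∈ S → F w z ≡ true → z ∈ S

  Exit : Subset n → Set
  Exit S = ∃₂ λ w z → w ∈ S × z ∉ S × F w z ≡ true

  exit? : ∀ S → Dec (Exit S)
  exit? S = Fin.any? λ w → Fin.any? λ z → w ∈? S ×-dec ¬? (z ∈? S) ×-dec F w z ≟ᵇ true

  ¬exit⇒closed : ∀ {S} → ¬ Exit S → Closed S
  ¬exit⇒closed {S} ¬exit {w} {z} w∈S e = decidable-stable (z ∈? S) λ z∉S → ¬exit (w , z , w∈S , z∉S , e)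

  full⇒closed : ∀ {S} → n ≤ ∣ S ∣ → Closed S
  full⇒closed {S} full _ _ = subst (_ ∈_) (≡-sym (∣p∣≡n⇒p≡⊤ (ℕ.≤-antisym (∣p∣≤n S) full))) ∈⊤

  ReachableFrom : Fin n → Subset n → Set
  ReachableFrom u S = ∀ {w} → w ∈ S → Path F u w

  closure : ∀ fuel {u} S → n ≤ fuel + ∣ S ∣ → ReachableFrom u S →
            Σ[ T ∈ Subset n ] S ⊆ T × Closed T × ReachableFrom u T
  closure zero          S full  reach = S , id , full⇒closed full , reach
  closure (suc fuel) {u} S bound reach with exit? S
  ... | no ¬exit = S , id , ¬exit⇒closed ¬exit , reach
  ... | yes (w , z , w∈S , z∉S , e) =
    let T , S∪z⊆T , T-closed , T-reach = closure fuel (S ∪ ⁅ z ⁆) bound′ reach′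
    in T , S∪z⊆T ∘ p⊆p∪q _ , T-closed , T-reach
    where
    grows : ∣ S ∣ < ∣ S ∪ ⁅ z ⁆ ∣
    grows = p⊂q⇒∣p∣<∣q∣ (p⊆p∪q _ , z , x∈p∪q⁺ (inj₂ (x∈⁅x⁆ z)) , z∉S)
    bound′ : n ≤ fuel + ∣ S ∪ ⁅ z ⁆ ∣
    bound′ = ℕ.≤-trans bound (ℕ.≤-trans (ℕ.≤-reflexive (≡-sym (ℕ.+-suc fuel ∣ S ∣))) (ℕ.+-monoʳ-≤ fuel grows))
    reach′ : ReachableFrom u (S ∪ ⁅ z ⁆)
    reach′ y∈ with x∈p∪q⁻ S ⁅ z ⁆ y∈
    ... | inj₁ y∈S = reach y∈S
    ... | inj₂ y∈z rewrite x∈⁅y⁆⇒x≡y z y∈z = path-snoc (reach w∈S) e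

  reachable-closed-set : ∀ u → Σ[ S ∈ Subset n ] u ∈ S × Closed S × ReachableFrom u S
  reachable-closed-set u =
    let S , ⁅u⁆⊆S , S-closed , S-reach = closure n ⁅ u ⁆ (ℕ.m≤m+n n _) reach-⁅u⁆
    in S , ⁅u⁆⊆S (x∈⁅x⁆ u) , S-closed , S-reach
    where
    reach-⁅u⁆ : ReachableFrom u ⁅ u ⁆
    reach-⁅u⁆ w∈ rewrite x∈⁅y⁆⇒x≡y u w∈ = here

  closed⇒side-resp : (∀ u v → F u v ≡ F v u) → ∀ {S} → Closed S →
                     ∀ {w z} → F w z ≡ true → does (w ∈? S) ≡ does (z ∈? S)
  closed⇒side-resp F-sym {S} S-closed {w} {z} e with w ∈? S | z ∈? S
  ... | yes _   | yes _   = refl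
  ... | no _    | no _    = refl
  ... | yes w∈S | no z∉S  = ⊥-elim (z∉S (S-closed w∈S e))
  ... | no w∉S  | yes z∈S = ⊥-elim (w∉S (S-closed z∈S (trans (F-sym z w) e)))

  closed-set⇒separation : (∀ u v → F u v ≡ F v u) → ∀ {S u v} → Closed S → u ∈ S → v ∉ S → Separation F
  closed-set⇒separation F-sym {S} {u} {v} S-closed u∈S v∉S = record
    { side       = λ w → does (w ∈? S)
    ; side-resp  = closed⇒side-resp F-sym S-closed
    ; inner      = u
    ; outer      = v
    ; inner-side = dec-true (u ∈? S) u∈S
    ; outer-side = dec-false (v ∈? S) v∉S
    }

  disconnected⇒separation : (∀ u v → F u v ≡ F v u) → ¬ ConnectedRel F → Separation F
  disconnected⇒separation F-sym disconnected =
    let u , v , v∉ = unreached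
        _ , u∈ , closed , _ = reachable-closed-set u
    in closed-set⇒separation F-sym closed u∈ v∉
    where
    S : Fin n → Subset n
    S u = proj₁ (reachable-closed-set u)
    unreached : ∃₂ λ u v → v ∉ S u
    unreached =
      let u , ¬all = Fin.¬∀⟶∃¬ n (λ u → ∀ v → v ∈ S u) (λ u → Fin.all? (_∈? S u))
                       (λ all → disconnected λ u v → proj₂ (proj₂ (proj₂ (reachable-closed-set u))) (all u v))
      in u , Fin.¬∀⟶∃¬ n (_∈ S u) (_∈? S u) ¬all

module _ {n m : ℕ} (G : Graph n) (b : Fin m → Fin n × Fin n) (bond : IsBond G b) where

  private
    E∖b : EdgeRel n
    E∖b = E G minus edgesOf b everything

  edge-outside-bond-or-kept : ∀ j {w z} → (E G minus edgesOf b (allBut j)) w z ≡ true →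
                              E∖b w z ≡ true ⊎ isEdge (b j) w z ≡ true
  edge-outside-bond-or-kept j {w} {z} e with edgesOf b everything w z ≟ᵇ true
  ... | no ¬in-bond =
    inj₁ (minus⁺ (E G) (edgesOf b everything) (proj₁ (minus⁻ (E G) (edgesOf b (allBut j)) e)) (¬-not ¬in-bond))
  ... | yes in-bond with edgesOf⁻ b in-bond
  ...   | j′ , _ , wz≡bj′ with j′ ≟ j
  ...     | yes refl = inj₂ wz≡bj′
  ...     | no j′≢j  = contradiction (trans (≡-sym (edgesOf⁺ b j′ (allBut-≢ j′≢j) wz≡bj′)) not-kept) λ ()
    where
    not-kept : edgesOf b (allBut j) w z ≡ false
    not-kept = proj₂ (minus⁻ (E G) (edgesOf b (allBut j)) e)

  E∖b-sym : ∀ u v → E∖b u v ≡ E∖b v u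
  E∖b-sym u v = cong₂ (λ x y → x ∧ not y) (Graph.sym G u v) (edgesOf-sym b everything u v)

  bond-separation : Separation E∖b
  bond-separation = disconnected⇒separation E∖b E∖b-sym (proj₁ (proj₂ bond))

  open Separation bond-separation

  bond-edge-crosses : ∀ i → ∃₂ λ w z → side w ≡ true × side z ≡ false × Endpoint (b i) w × Endpoint (b i) z
  bond-edge-crosses i with path-crosses _ side (proj₂ (proj₂ bond) i inner outer) inner-side outer-side
  ... | w , z , w-in , z-out , e with edge-outside-bond-or-kept i e
  ...   | inj₁ e′    = contradiction (trans (≡-sym w-in) (trans (side-resp e′) z-out)) λ ()
  ...   | inj₂ wz≡bi = w , z , w-in , z-out , isEdge⇒endpoints (b i) wz≡bi

  endpoint-on-side : ∀ i s → Σ[ w ∈ Fin n ] Endpoint (b i) w × side w ≡ s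
  endpoint-on-side i true  = let w , _ , w-in , _  , w-end , _     = bond-edge-crosses i in w , w-end , w-in
  endpoint-on-side i false = let _ , z , _ , z-out , _     , z-end = bond-edge-crosses i in z , z-end , z-out

  step-keeps-side : ∀ j {w v} → ¬ Endpoint (b j) w → (E G minus edgesOf b (allBut j)) w v ≡ true → side v ≡ side w
  step-keeps-side j w-free e with edge-outside-bond-or-kept j e
  ... | inj₁ e′    = ≡-sym (side-resp e′)
  ... | inj₂ wv≡bj = contradiction (proj₁ (isEdge⇒endpoints (b j) wv≡bj)) w-free

  bond-edges⊆E : ∀ S u v → edgesOf b S u v ≡ true → E G u v ≡ true
  bond-edges⊆E S u v e with edgesOf⁻ b e
  ... | j , _ , uv≡bj with isEdge⁻ (b j) uv≡bj
  ...   | inj₁ bj≡uv = subst (λ e → E G (proj₁ e) (proj₂ e) ≡ true) bj≡uv (proj₁ bond j)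
  ...   | inj₂ bj≡vu = trans (Graph.sym G u v) (subst (λ e → E G (proj₁ e) (proj₂ e) ≡ true) bj≡vu (proj₁ bond j))

Occupied : ∀ {n m k} → (Fin m → Fin n × Fin n) → (Fin k → Fin n) → Fin m → Set
Occupied b pos j = ∃ λ a → Endpoint (b j) (pos a)

module _ {n m : ℕ} {b : Fin m → Fin n × Fin n} (matching : IsMatching b) where

  shared-endpoint⇒≡ : ∀ {i j w} → Endpoint (b i) w → Endpoint (b j) w → i ≡ j
  shared-endpoint⇒≡ {i} {j} p q = decidable-stable (i ≟ j) λ i≢j → disjoint (matching i j i≢j) p q
    where
    disjoint : ∀ {x y x′ y′ w : Fin n} → x ≢ x′ × x ≢ y′ × y ≢ x′ × y ≢ y′ →
               Endpoint (x , y) w → Endpoint (x′ , y′) w → ⊥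
    disjoint (d , _ , _ , _) (inj₁ refl) (inj₁ refl) = d refl
    disjoint (_ , d , _ , _) (inj₁ refl) (inj₂ refl) = d refl
    disjoint (_ , _ , d , _) (inj₂ refl) (inj₁ refl) = d refl
    disjoint (_ , _ , _ , d) (inj₂ refl) (inj₂ refl) = d refl

  unoccupied-edge : ∀ {k} → k < m → (pos : Fin k → Fin n) → ∃ λ j → ¬ Occupied b pos j
  unoccupied-edge k<m pos = Fin.¬∀⟶∃¬ _ (Occupied b pos) occupied? ¬all-occupied
    where
    occupied? : ∀ j → Dec (Occupied b pos j)
    occupied? j = Fin.any? λ a → pos a ≟ proj₁ (b j) ⊎-dec pos a ≟ proj₂ (b j)
    ¬all-occupied : ¬ (∀ j → Occupied b pos j)
    ¬all-occupied occ =
      let i , j , i<j , same = Fin.pigeonhole k<m (proj₁ ∘ occ)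
      in Fin.<⇒≢ i<j (shared-endpoint⇒≡ (proj₂ (occ i)) (subst (Endpoint (b j) ∘ pos) (≡-sym same) (proj₂ (occ j))))

  endpoints-injective : ∀ {k} {ι : Fin k → Fin m} {p : Fin k → Fin n} → Injective _≡_ _≡_ ι →
                        (∀ a → Endpoint (b (ι a)) (p a)) → Injective _≡_ _≡_ p
  endpoints-injective ι-injective p-end {a} {a′} same =
    ι-injective (shared-endpoint⇒≡ (p-end a) (subst (Endpoint (b _)) (≡-sym same) (p-end a′)))

module _ {n : ℕ} (G : Graph n) {k : ℕ} where
  open Game G k

  Separated : (Fin n → Bool) → State → Set
  Separated side s = ∀ a → side (pos s a) ≡ not (inf s a)

  module _ (side : Fin n → Bool) {s : State} (separated : Separated side s)
           {p : Fin k → Fin n} (keeps-side : ∀ a → side (p a) ≡ side (pos s a)) where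

    update-keeps-knowledge : ∀ a → inf (update s p) a ≡ inf s a
    update-keeps-knowledge a with inf s a in a-status
    ... | true  = refl
    ... | false = ¬-not λ meets-source →
      let c , t = satisfied (any⁻ _ (allFin k) (T-≡ .from meets-source))
      in contradiction (sides-differ c (T-≡ .to (proj₁ (T-∧ .to t))) (toWitness {a? = p c ≟ p a} (proj₂ (T-∧ .to t)))) λ ()
      where
      open ≡-Reasoning
      sides-differ : ∀ c → inf s c ≡ true → p c ≡ p a → true ≡ false
      sides-differ c c-source same = begin
        true              ≡⟨ cong not a-status ⟨
        not (inf s a)     ≡⟨ separated a ⟨
        side (pos s a)    ≡⟨ keeps-side a ⟨
        side (p a)        ≡⟨ cong side same ⟨
        side (p c)        ≡⟨ keeps-side c ⟩
        side (pos s c)    ≡⟨ separated c ⟩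
        not (inf s c)     ≡⟨ cong not c-source ⟩
        false             ∎

    update-keeps-separated : Separated side (update s p)
    update-keeps-separated a = begin
      side (p a)                 ≡⟨ keeps-side a ⟩
      side (pos s a)             ≡⟨ separated a ⟩
      not (inf s a)              ≡⟨ cong not (update-keeps-knowledge a) ⟨
      not (inf (update s p) a)   ∎
      where open ≡-Reasoning

module Blockade {n m : ℕ} (G : Graph n) (b : Fin m → Fin n × Fin n) (bond : IsBond G b)
                (matching : IsMatching b) {k : ℕ} (k<m : k < m) where
  open Game G k
  open Separation (bond-separation G b bond) using (side)

  keep-only : Fin m → Removal
  keep-only j = record
    { R    = edgesOf b (allBut j)
    ; R⊆E  = bond-edges⊆E G b bond (allBut j)
    ; Rsym = edgesOf-sym b (allBut j)
    ; conn = proj₂ (proj₂ bond) j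
    }

  blockade : State → Removal
  blockade s = keep-only (proj₁ (unoccupied-edge matching k<m (pos s)))

  adversary : AdvStrategy
  adversary = blockade ∘ current

  keep-only-keeps-side : ∀ s j → ¬ Occupied b (pos s) j → (mv : Moves s (keep-only j)) →
                         ∀ a → side (proj₁ (mv a)) ≡ side (pos s a)
  keep-only-keeps-side s j unoccupied mv a with proj₂ (mv a)
  ... | inj₁ stays = cong side stays
  ... | inj₂ e     = step-keeps-side G b bond j (λ end → unoccupied (a , end)) e

  blockade-invariant : ∀ {s₀} → Separated G side s₀ → ∀ P t →
                       let s = current (play s₀ adversary P t) in Separated G side s × (∀ a → inf s a ≡ inf s₀ a)
  blockade-invariant separated₀ P zero    = separated₀ , λ _ → refl
  blockade-invariant {s₀} separated₀ P (suc t) =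
    let separated , same = blockade-invariant separated₀ P t
        keeps-side = keep-only-keeps-side (current h) _ (proj₂ (unoccupied-edge matching k<m _)) (P h (adversary h))
    in update-keeps-separated G side {s = current h} separated keeps-side ,
       λ a → trans (update-keeps-knowledge G side {s = current h} separated keeps-side a) (same a)
    where
    h : History
    h = play s₀ adversary P t

  home : (src : Fin k → Bool) → ∀ a → Σ[ w ∈ Fin n ] Endpoint (b (inject≤ a (ℕ.<⇒≤ k<m))) w × side w ≡ not (src a)
  home src a = endpoint-on-side G b bond (inject≤ a (ℕ.<⇒≤ k<m)) (not (src a))

  placement : (Fin k → Bool) → Fin k → Fin n
  placement src = proj₁ ∘ home src

  placement-injective : ∀ src → Injective _≡_ _≡_ (placement src)
  placement-injective src = endpoints-injective matching (Fin.inject≤-injective _ _ _ _) (proj₁ ∘ proj₂ ∘ home src)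

  placement-separated : ∀ src → Separated G side ⟨ placement src , src ⟩
  placement-separated src = proj₂ ∘ proj₂ ∘ home src

matching-bond⇒adversary-wins : ∀ {n m} (G : Graph n) (b : Fin m → Fin n × Fin n) → IsBond G b → IsMatching b →
                               ∀ k₁ k₂ → suc k₁ + k₂ < m → AdversaryWins G (suc k₁) k₂
matching-bond⇒adversary-wins G b bond matching k₁ k₂ k<m =
  placement src , placement-injective src , adversary , λ P t all-sources →
    contradiction (trans (≡-sym (all-sources fzero)) (proj₂ (blockade-invariant (placement-separated src) P t) fzero)) λ ()
  where
  open Blockade G b bond matching k<m
  -- Agent 0 starts ignorant, as suc k₁ ≤ᵇ 0 computes to false, and the invariant keeps it so.
  src : Fin (suc k₁ + k₂) → Bool
  src a = suc k₁ ≤ᵇ toℕ a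

theorem13 : ∀ {n} (G : Graph n) → Connected G →
    (m : ℕ) → HasMatchingBond G m →
    (k₁ k₂ : ℕ) → 1 ≤ k₁ → 1 ≤ k₂ → k₁ + k₂ ≤ m ∸ 1 →
    AdversaryWins G k₁ k₂
-- Connectivity of G already follows from the bond, and no source agent is needed.
theorem13 G _ zero    _                     (suc k₁) k₂ (s≤s z≤n) _ ()
theorem13 G _ (suc m) (b , bond , matching) (suc k₁) k₂ (s≤s z≤n) _ k≤m =
  matching-bond⇒adversary-wins G b bond matching k₁ k₂ (s≤s k≤m)
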